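{- Let $G=(V,E,w)$ be a finite simple undirected graph with positive vertex weights containing a path $v_1v_2v_3v_4v_5$ (five distinct vertices) such that $d_G(v_2)=d_G(v_3)=d_G(v_4)=2$ and $w(v_1)\ge w(v_2)\ge w(v_3)\le w(v_4)\le w(v_5)$. Let $G'$ be the weighted graph obtained from $G$ by deleting $v_2$ and $v_4$, adding the edges $v_1v_3$ and $v_3v_5$, changing the weight of $v_1$ to $w(v_1)+w(v_3)-w(v_2)$ and the weight of $v_5$ to $w(v_5)+w(v_3)-w(v_4)$ (all other weights unchanged). Then $\alpha(G)=\alpha(G')+w(v_2)+w(v_4)-w(v_3)$.
   Context: $\alpha(H)$ denotes the maximum total vertex weight of an independent set in the weighted graph $H$; $d_G(v)$ is the degree of $v$ in $G$.
   Formalization: The vertex weights of G are positive rationals, so α and the weights of G′ are rational as well. -}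

module Defs where

open import Data.Nat using (ℕ; zero; suc)
open import Data.Bool using (Bool; true; false; _∧_; _∨_; not; if_then_else_)
open import Data.Fin using (Fin; _≟_)
open import Data.Fin.Subset using (Subset)
open import Data.Vec using (Vec; []; _∷_; lookup; tabulate)
open import Data.List using (List; []; _∷_; _++_; foldr; map; allFin)
open import Data.Product using (_×_)
open import Relation.Binary.PropositionalEquality using (_≡_)
open import Data.Rational using (ℚ; 0ℚ; Positive; _+_; _-_; _⊔_)
open import Relation.Nullary.Decidable using (⌊_⌋)

record WGraph (n : ℕ) : Set where
  field
    verts  : Subset n
    adj    : Fin n → Fin n → Bool
    weight : Fin n → ℚ
open WGraph public

_==_ : ∀ {n} → Fin n → Fin n → Bool
i == j = ⌊ i ≟ j ⌋

_∈ᵇ_ : ∀ {n} → Fin n → Subset n → Bool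
i ∈ᵇ S = lookup S i

IsSimple : ∀ {n} → WGraph n → Set
IsSimple {n} G = (∀ (i j : Fin n) → adj G i j ≡ adj G j i) × (∀ (i : Fin n) → adj G i i ≡ false)

PositiveWeights : ∀ {n} → WGraph n → Set
PositiveWeights {n} G = ∀ (i : Fin n) → i ∈ᵇ verts G ≡ true → Positive (weight G i)

degree : ∀ {n} → WGraph n → Fin n → ℕ
degree {n} G v = foldr (λ j k → if (j ∈ᵇ verts G) ∧ adj G v j then suc k else k) 0 (allFin n)

allᵇ : ∀ {A : Set} → (A → Bool) → List A → Bool
allᵇ p = foldr (λ x b → p x ∧ b) true

allSubsets : ∀ n → List (Subset n)
allSubsets zero = [] ∷ []
allSubsets (suc n) = map (true ∷_) (allSubsets n) ++ map (false ∷_) (allSubsets n)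

isIndependent : ∀ {n} → WGraph n → Subset n → Bool
isIndependent {n} G S =
  allᵇ (λ i → not (i ∈ᵇ S) ∨ (i ∈ᵇ verts G)) (allFin n) ∧
  allᵇ (λ i → allᵇ (λ j → not ((i ∈ᵇ S) ∧ (j ∈ᵇ S) ∧ adj G i j)) (allFin n)) (allFin n)

setWeight : ∀ {n} → WGraph n → Subset n → ℚ
setWeight {n} G S = foldr (λ i q → (if i ∈ᵇ S then weight G i else 0ℚ) + q) 0ℚ (allFin n)

-- α(G): maximum total weight of an independent set of G
-- (the empty set is independent with weight 0, so starting the max at 0 is harmless)
α : ∀ {n} → WGraph n → ℚ
α {n} G = foldr _⊔_ 0ℚ
  (map (λ S → if isIndependent G S then setWeight G S else 0ℚ) (allSubsets n))

reduce : ∀ {n} → WGraph n → (v₁ v₂ v₃ v₄ v₅ : Fin n) → WGraph n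
reduce G v₁ v₂ v₃ v₄ v₅ = record
  { verts  = tabulate (λ i → (i ∈ᵇ verts G) ∧ not (i == v₂) ∧ not (i == v₄))
  ; adj    = λ i j → adj G i j ∨ edge i j v₁ v₃ ∨ edge i j v₃ v₅
  ; weight = λ i → if i == v₁ then weight G v₁ + weight G v₃ - weight G v₂
                   else if i == v₅ then weight G v₅ + weight G v₃ - weight G v₄
                   else weight G i
  }
  where
  edge : _ → _ → _ → _ → Bool
  edge i j a b = (i == a ∧ j == b) ∨ (i == b ∧ j == a)

-- Transport independent sets between G and G′ by changing them only on v₂, v₃, v₄, which have
-- no neighbours off the path.  An independent set S of G becomes one of G′ by dropping v₂, v₄
-- and keeping v₃ exactly when S contained both v₂ and v₄; an independent set S of G′ becomes one
-- of G by adding v₂ unless v₁ ∈ S, adding v₄ unless v₅ ∈ S, and keeping v₃ exactly when v₁, v₅ ∈ S.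
-- The two weight functions agree off the path, so comparing the weights only involves the five
-- path vertices: the first map loses at most c = w₂ + w₄ − w₃ (this uses w₃ ≤ w₂, w₄ and w ≥ 0),
-- the second gains at least c.  As α is attained by an independent set, α(G) = α(G′) + c.
{-# OPTIONS --safe #-}
module Submission where

open import Defs
open import Algebra.Bundles using (CommutativeMonoid)
open import Data.Bool using (Bool; true; false; _∧_; _∨_; not; if_then_else_)
open import Data.Bool.Properties
  using (∧-comm; ∨-comm; ∧-zeroʳ; ∨-zeroʳ; ∨-identityʳ; ∨-conicalˡ; not-¬; ¬-not; not-injective)
open import Data.Empty using (⊥-elim)
open import Data.Fin using (Fin; zero; suc; _≟_)
open import Data.Fin.Subset using (Subset) renaming (⊥ to ∅)
open import Data.List using (List; []; _∷_)
import Data.List as List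
open import Data.List.Membership.Propositional using (_∈_)
open import Data.List.Membership.Propositional.Properties using (∈-++⁺ˡ; ∈-++⁺ʳ; ∈-map⁺)
open import Data.List.Relation.Unary.All using (All; []; _∷_)
open import Data.List.Relation.Unary.AllPairs using (AllPairs; []; _∷_)
open import Data.List.Relation.Unary.Any using (here; there)
open import Data.Nat as ℕ using (ℕ; s≤s)
import Data.Nat.Properties as ℕ
open import Data.Product using (_×_; _,_; proj₁; proj₂; ∃-syntax)
open import Data.Rational as ℚ using (ℚ; 0ℚ; 1ℚ; _+_; _-_; _*_; _≤_; _⊔_)
import Data.Rational.Properties as ℚ
open import Data.Sum using (_⊎_; inj₁; inj₂; [_,_]′)
import Data.Vec as Vec
open import Data.Vec using (_[_]≔_)
open import Data.Vec.Properties using (lookup∘tabulate; lookup-replicate; lookup∘updateAt; lookup∘updateAt′)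
open import Data.Vec.Functional as Vector using (Vector; updateAt)
open import Data.Vec.Functional.Properties using (updateAt-updates; updateAt-minimal)
open import Function using (_∘_; const; id)
open import Level using (0ℓ)
open import Relation.Binary.PropositionalEquality
  using (_≡_; _≢_; _≗_; refl; sym; trans; cong; cong₂; subst; subst₂; module ≡-Reasoning)
open import Relation.Nullary using (Dec; yes; no; ¬_)
open import Relation.Nullary.Decidable using (isYes≗does; dec-true; dec-false; dec⇒maybe)
open import Tactic.RingSolver using (solve-∀; solve)
open import Tactic.RingSolver.Core.AlmostCommutativeRing using (AlmostCommutativeRing; fromCommutativeRing)

==-refl : ∀ {n} (i : Fin n) → (i == i) ≡ true
==-refl i = trans (isYes≗does (i ≟ i)) (dec-true (i ≟ i) refl)

==-≢ : ∀ {n} {i j : Fin n} → i ≢ j → (i == j) ≡ false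
==-≢ {i = i} {j} i≢j = trans (isYes≗does (i ≟ j)) (dec-false (i ≟ j) i≢j)

==⇒≡ : ∀ {n} {i j : Fin n} → (i == j) ≡ true → i ≡ j
==⇒≡ {i = i} {j} i==j with i ≟ j
... | yes i≡j = i≡j
... | no  _   with () ← i==j

not-==⇒≢ : ∀ {n} {i j : Fin n} → not (i == j) ≡ true → i ≢ j
not-==⇒≢ {i = i} h refl = not-¬ (==-refl i) (not-injective h)

∧-true : ∀ {x y} → x ∧ y ≡ true → x ≡ true × y ≡ true
∧-true {true} h = refl , h

∧-false : ∀ {x y} → x ∧ y ≡ false → y ≡ true → x ≡ false
∧-false {false} _ _    = refl
∧-false {true}  h refl = h

∨-true : ∀ {x y} → x ∨ y ≡ true → x ≡ true ⊎ y ≡ true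
∨-true {true}  _ = inj₁ refl
∨-true {false} h = inj₂ h

not-true : ∀ {x} → not x ≡ true → x ≡ false
not-true {false} _ = refl

not-∨-elim : ∀ {x y} → not x ∨ y ≡ true → x ≡ true → y ≡ true
not-∨-elim h refl = h

not-∨-intro : ∀ {x y} → (x ≡ true → y ≡ true) → not x ∨ y ≡ true
not-∨-intro {false} _ = refl
not-∨-intro {true}  h = h refl

nand-elim : ∀ {x y z} → not (x ∧ y ∧ z) ≡ true → x ≡ true → y ≡ true → z ≡ false
nand-elim h refl refl = not-injective h

nand-intro : ∀ {x y z} → (x ≡ true → y ≡ true → z ≡ false) → not (x ∧ y ∧ z) ≡ true
nand-intro {false}        _ = refl
nand-intro {true} {false} _ = refl
nand-intro {true} {true}  h = cong not (h refl refl)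

module FiniteSum {c ℓ} (M : CommutativeMonoid c ℓ) where

  open CommutativeMonoid M renaming (sym to ≈-sym) hiding (refl; trans)
  open import Algebra.Properties.CommutativeMonoid.Sum M public
    using (sum; sum-cong-≗; sum-replicate-zero)
  open import Relation.Binary.Reasoning.Setoid setoid

  sumAt : ∀ {n} → List (Fin n) → Vector Carrier n → Carrier
  sumAt []      f = ε
  sumAt (v ∷ L) f = f v ∙ sumAt L f

  erase : ∀ {n} → Fin n → Vector Carrier n → Vector Carrier n
  erase v f = updateAt f v (const ε)

  eraseAll : ∀ {n} → List (Fin n) → Vector Carrier n → Vector Carrier n
  eraseAll []      f = f
  eraseAll (v ∷ L) f = eraseAll L (erase v f)

  sum-erase : ∀ {n} (f : Vector Carrier n) v → sum f ≈ sum (erase v f) ∙ f v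
  sum-erase f zero    = begin
    f zero ∙ sum (f ∘ suc)         ≈⟨ comm _ _ ⟩
    sum (f ∘ suc) ∙ f zero         ≈⟨ ∙-congʳ (≈-sym (identityˡ _)) ⟩
    (ε ∙ sum (f ∘ suc)) ∙ f zero   ∎
  sum-erase f (suc v) = begin
    f zero ∙ sum (f ∘ suc)                           ≈⟨ ∙-congˡ (sum-erase (f ∘ suc) v) ⟩
    f zero ∙ (sum (erase v (f ∘ suc)) ∙ f (suc v))   ≈⟨ ≈-sym (assoc _ _ _) ⟩
    (f zero ∙ sum (erase v (f ∘ suc))) ∙ f (suc v)   ∎

  sumAt-erase : ∀ {n} (f : Vector Carrier n) {v} L → All (v ≢_) L → sumAt L (erase v f) ≡ sumAt L f
  sumAt-erase f []      []          = refl
  sumAt-erase f (u ∷ L) (v≢u ∷ v∉L) =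
    cong₂ _∙_ (updateAt-minimal u _ f (v≢u ∘ sym)) (sumAt-erase f L v∉L)

  sum-eraseAll : ∀ {n} (f : Vector Carrier n) L → AllPairs _≢_ L →
                 sum f ≈ sum (eraseAll L f) ∙ sumAt L f
  sum-eraseAll f []      []               = ≈-sym (identityʳ _)
  sum-eraseAll f (v ∷ L) (v∉L ∷ distinct) = begin
    sum f                                              ≈⟨ sum-erase f v ⟩
    sum (erase v f) ∙ f v                              ≈⟨ ∙-congʳ (sum-eraseAll (erase v f) L distinct) ⟩
    (sum rest ∙ sumAt L (erase v f)) ∙ f v             ≡⟨ cong (λ x → (sum rest ∙ x) ∙ f v)
                                                                (sumAt-erase f L v∉L) ⟩
    (sum rest ∙ sumAt L f) ∙ f v                       ≈⟨ assoc _ _ _ ⟩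
    sum rest ∙ (sumAt L f ∙ f v)                       ≈⟨ ∙-congˡ (comm _ _) ⟩
    sum rest ∙ (f v ∙ sumAt L f)                       ∎
    where rest = eraseAll L (erase v f)

  eraseAll-cong : ∀ {n} {f g : Vector Carrier n} L → (∀ i → All (i ≢_) L → f i ≡ g i) →
                  eraseAll L f ≗ eraseAll L g
  eraseAll-cong               []      f≡g i = f≡g i []
  eraseAll-cong {f = f} {g} (v ∷ L) f≡g   = eraseAll-cong L erased-agree
    where
    erased-agree : ∀ i → All (i ≢_) L → erase v f i ≡ erase v g i
    erased-agree i i∉L with i ≟ v
    ... | yes refl = trans (updateAt-updates v f) (sym (updateAt-updates v g))
    ... | no  i≢v  = trans (updateAt-minimal i v f i≢v)
                       (trans (f≡g i (i≢v ∷ i∉L)) (sym (updateAt-minimal i v g i≢v)))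

module ℕ-Sum = FiniteSum ℕ.+-0-commutativeMonoid
module ℚ-Sum = FiniteSum ℚ.+-0-commutativeMonoid

foldr-tabulate : ∀ {A B : Set} {_∙_ : B → B → B} {e : B} (f : A → B → B) (h : A → B) →
                 (∀ x acc → f x acc ≡ h x ∙ acc) →
                 ∀ {n} (g : Fin n → A) → List.foldr f e (List.tabulate g) ≡ Vector.foldr _∙_ e (h ∘ g)
foldr-tabulate f h step {ℕ.zero}  g = refl
foldr-tabulate f h step {ℕ.suc n} g =
  trans (cong (f (g zero)) (foldr-tabulate f h step (g ∘ suc))) (step (g zero) _)

allᵇ-tabulate⁻ : ∀ {A : Set} {n} {p : A → Bool} (g : Fin n → A) →
                 allᵇ p (List.tabulate g) ≡ true → ∀ i → p (g i) ≡ true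
allᵇ-tabulate⁻ g h zero    = proj₁ (∧-true h)
allᵇ-tabulate⁻ g h (suc i) = allᵇ-tabulate⁻ (g ∘ suc) (proj₂ (∧-true h)) i

allᵇ-tabulate⁺ : ∀ {A : Set} {n} {p : A → Bool} (g : Fin n → A) →
                 (∀ i → p (g i) ≡ true) → allᵇ p (List.tabulate g) ≡ true
allᵇ-tabulate⁺ {n = ℕ.zero}  g h = refl
allᵇ-tabulate⁺ {n = ℕ.suc n} g h = cong₂ _∧_ (h zero) (allᵇ-tabulate⁺ (g ∘ suc) (h ∘ suc))

allᵇ-allFin⁻ : ∀ {n} {p : Fin n → Bool} → allᵇ p (List.allFin n) ≡ true → ∀ i → p i ≡ true
allᵇ-allFin⁻ = allᵇ-tabulate⁻ id

allᵇ-allFin⁺ : ∀ {n} {p : Fin n → Bool} → (∀ i → p i ≡ true) → allᵇ p (List.allFin n) ≡ true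
allᵇ-allFin⁺ = allᵇ-tabulate⁺ id

record Independent {n} (H : WGraph n) (S : Subset n) : Set where
  field
    ⊆-verts : ∀ {i} → i ∈ᵇ S ≡ true → i ∈ᵇ verts H ≡ true
    no-edge : ∀ {i j} → i ∈ᵇ S ≡ true → j ∈ᵇ S ≡ true → adj H i j ≡ false
open Independent

isIndependent⇒Independent : ∀ {n} {H : WGraph n} {S} → isIndependent H S ≡ true → Independent H S
isIndependent⇒Independent {n} {H} {S} h = record
  { ⊆-verts = λ {i} → not-∨-elim (allᵇ-allFin⁻ (proj₁ h′) i)
  ; no-edge = λ {i} {j} → nand-elim (allᵇ-allFin⁻ (allᵇ-allFin⁻ (proj₂ h′) i) j)
  }
  where h′ = ∧-true {allᵇ (λ i → not (i ∈ᵇ S) ∨ (i ∈ᵇ verts H)) (List.allFin n)} h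

Independent⇒isIndependent : ∀ {n} {H : WGraph n} {S} → Independent H S → isIndependent H S ≡ true
Independent⇒isIndependent ind =
  cong₂ _∧_ (allᵇ-allFin⁺ λ i → not-∨-intro (⊆-verts ind {i}))
            (allᵇ-allFin⁺ λ i → allᵇ-allFin⁺ λ j → nand-intro (no-edge ind {i} {j}))

∅-independent : ∀ {n} (H : WGraph n) → Independent H ∅
∅-independent H = record
  { ⊆-verts = λ {i} i∈∅ → ⊥-elim (not-¬ i∈∅ (lookup-replicate i false))
  ; no-edge = λ {i} i∈∅ _ → ⊥-elim (not-¬ i∈∅ (lookup-replicate i false))
  }

edge-not-both : ∀ {n} {H : WGraph n} {S a b} → Independent H S → adj H a b ≡ true →
                a ∈ᵇ S ∧ b ∈ᵇ S ≡ false
edge-not-both {S = S} {a} {b} ind ab with a ∈ᵇ S in a∈S | b ∈ᵇ S in b∈S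
... | false | _     = refl
... | true  | false = refl
... | true  | true  = ⊥-elim (not-¬ ab (no-edge ind a∈S b∈S))

∈∉⇒≢ : ∀ {n} {S : Subset n} {i j} → i ∈ᵇ S ≡ true → j ∈ᵇ S ≡ false → i ≢ j
∈∉⇒≢ i∈S j∉S refl = not-¬ i∈S j∉S

≔-here : ∀ {n} (S : Subset n) v {b} → v ∈ᵇ (S [ v ]≔ b) ≡ b
≔-here S v = lookup∘updateAt v S

≔-there : ∀ {n} (S : Subset n) {v b i} → i ≢ v → i ∈ᵇ (S [ v ]≔ b) ≡ i ∈ᵇ S
≔-there S {v} {i = i} i≢v = lookup∘updateAt′ i v i≢v S

∈-≔ : ∀ {n} {S : Subset n} {v b i} → i ∈ᵇ (S [ v ]≔ b) ≡ true →
      (i ≡ v × b ≡ true) ⊎ (i ≢ v × i ∈ᵇ S ≡ true)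
∈-≔ {S = S} {v} {i = i} h with i ≟ v
... | yes refl = inj₁ (refl , trans (sym (≔-here S v)) h)
... | no  i≢v  = inj₂ (i≢v , trans (sym (≔-there S i≢v)) h)

NoNeighbourIn : ∀ {n} → WGraph n → Fin n → Subset n → Set
NoNeighbourIn H v S = ∀ {j} → j ∈ᵇ S ≡ true → adj H v j ≡ false

Independent-≔ : ∀ {n} {H : WGraph n} {S v b} → IsSimple H → Independent H S →
                (b ≡ true → v ∈ᵇ verts H ≡ true × NoNeighbourIn H v S) →
                Independent H (S [ v ]≔ b)
Independent-≔ {H = H} {S} {v} {b} (symmetric , loopless) ind addable = record
  { ⊆-verts = ⊆-verts′ ; no-edge = no-edge′ }
  where
  ⊆-verts′ : ∀ {i} → i ∈ᵇ (S [ v ]≔ b) ≡ true → i ∈ᵇ verts H ≡ true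
  ⊆-verts′ i∈ with ∈-≔ {S = S} i∈
  ... | inj₁ (refl , b≡true) = proj₁ (addable b≡true)
  ... | inj₂ (_ , i∈S)       = ⊆-verts ind i∈S

  no-edge′ : ∀ {i j} → i ∈ᵇ (S [ v ]≔ b) ≡ true → j ∈ᵇ (S [ v ]≔ b) ≡ true → adj H i j ≡ false
  no-edge′ i∈ j∈ with ∈-≔ {S = S} i∈ | ∈-≔ {S = S} j∈
  ... | inj₁ (refl , _)      | inj₁ (refl , _)      = loopless v
  ... | inj₁ (refl , b≡true) | inj₂ (_ , j∈S)       = proj₂ (addable b≡true) j∈S
  ... | inj₂ (_ , i∈S)       | inj₁ (refl , b≡true) = trans (symmetric _ v) (proj₂ (addable b≡true) i∈S)
  ... | inj₂ (_ , i∈S)       | inj₂ (_ , j∈S)       = no-edge ind i∈S j∈S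

NeighboursWithin : ∀ {n} → WGraph n → Fin n → Fin n → Fin n → Set
NeighboursWithin H v a b = ∀ {j} → j ∈ᵇ verts H ≡ true → adj H v j ≡ true → j ≡ a ⊎ j ≡ b

NeighboursWithin⇒NoNeighbourIn : ∀ {n} {H : WGraph n} {v a b S} → NeighboursWithin H v a b →
                                 Independent H S → a ∈ᵇ S ≡ false → b ∈ᵇ S ≡ false →
                                 NoNeighbourIn H v S
NeighboursWithin⇒NoNeighbourIn {H = H} {v} N ind a∉S b∉S {j} j∈S with adj H v j in vj
... | false = refl
... | true with N (⊆-verts ind j∈S) vj
...   | inj₁ refl = ⊥-elim (not-¬ j∈S a∉S)
...   | inj₂ refl = ⊥-elim (not-¬ j∈S b∉S)

degree≡sum : ∀ {n} (H : WGraph n) v →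
             degree H v ≡ ℕ-Sum.sum (λ j → if j ∈ᵇ verts H ∧ adj H v j then 1 else 0)
degree≡sum H v = foldr-tabulate _ _ step id
  where
  step : ∀ j k → (if j ∈ᵇ verts H ∧ adj H v j then ℕ.suc k else k) ≡
                 (if j ∈ᵇ verts H ∧ adj H v j then 1 else 0) ℕ.+ k
  step j k with j ∈ᵇ verts H ∧ adj H v j
  ... | true  = refl
  ... | false = refl

sumAt≤sum : ∀ {n} (f : Fin n → ℕ) L → AllPairs _≢_ L → ℕ-Sum.sumAt L f ℕ.≤ ℕ-Sum.sum f
sumAt≤sum f L distinct =
  subst (ℕ-Sum.sumAt L f ℕ.≤_) (sym (ℕ-Sum.sum-eraseAll f L distinct)) (ℕ.m≤n+m _ _)

degree-2⇒NeighboursWithin : ∀ {n} (H : WGraph n) {v a b} → degree H v ≡ 2 → a ≢ b →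
                            a ∈ᵇ verts H ≡ true → adj H v a ≡ true →
                            b ∈ᵇ verts H ≡ true → adj H v b ≡ true →
                            NeighboursWithin H v a b
degree-2⇒NeighboursWithin H {v} {a} {b} deg a≢b a∈H va b∈H vb {j} j∈H vj with j ≟ a | j ≟ b
... | yes j≡a | _       = inj₁ j≡a
... | no  _   | yes j≡b = inj₂ j≡b
... | no  j≢a | no  j≢b = ⊥-elim (3≰2 (subst₂ ℕ._≤_ counted (trans (sym (degree≡sum H v)) deg)
                                         (sumAt≤sum neighbour (j ∷ a ∷ b ∷ []) distinct)))
  where
  neighbour : Fin _ → ℕ
  neighbour k = if k ∈ᵇ verts H ∧ adj H v k then 1 else 0

  counts : ∀ {k} → k ∈ᵇ verts H ≡ true → adj H v k ≡ true → neighbour k ≡ 1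
  counts = cong₂ (λ x y → if x ∧ y then 1 else 0)

  counted : ℕ-Sum.sumAt (j ∷ a ∷ b ∷ []) neighbour ≡ 3
  counted = cong₂ ℕ._+_ (counts j∈H vj) (cong₂ ℕ._+_ (counts a∈H va) (cong₂ ℕ._+_ (counts b∈H vb) refl))

  distinct : AllPairs _≢_ (j ∷ a ∷ b ∷ [])
  distinct = (j≢a ∷ j≢b ∷ []) ∷ (a≢b ∷ []) ∷ [] ∷ []

  3≰2 : ¬ 3 ℕ.≤ 2
  3≰2 (s≤s (s≤s ()))

≤-foldr-⊔ : ∀ {A : Set} (f : A → ℚ) {x xs} → x ∈ xs → f x ≤ List.foldr _⊔_ 0ℚ (List.map f xs)
≤-foldr-⊔ f (here refl)                = ℚ.p≤p⊔q _ _
≤-foldr-⊔ f {xs = y ∷ _} (there x∈xs) = ℚ.p≤q⇒p≤r⊔q (f y) (≤-foldr-⊔ f x∈xs)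

foldr-⊔-selective : ∀ {A : Set} (f : A → ℚ) xs →
                    List.foldr _⊔_ 0ℚ (List.map f xs) ≡ 0ℚ ⊎
                    ∃[ x ] List.foldr _⊔_ 0ℚ (List.map f xs) ≡ f x
foldr-⊔-selective f []       = inj₁ refl
foldr-⊔-selective f (x ∷ xs) with ℚ.⊔-sel (f x) (List.foldr _⊔_ 0ℚ (List.map f xs))
... | inj₁ max≡fx   = inj₂ (x , max≡fx)
... | inj₂ max≡rest with foldr-⊔-selective f xs
...   | inj₁ rest≡0        = inj₁ (trans max≡rest rest≡0)
...   | inj₂ (y , rest≡fy) = inj₂ (y , trans max≡rest rest≡fy)

allSubsets-complete : ∀ {n} (S : Subset n) → S ∈ allSubsets n
allSubsets-complete Vec.[]          = here refl
allSubsets-complete (true  Vec.∷ S) = ∈-++⁺ˡ (∈-map⁺ (true Vec.∷_) (allSubsets-complete S))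
allSubsets-complete (false Vec.∷ S) =
  ∈-++⁺ʳ (List.map (true Vec.∷_) (allSubsets _)) (∈-map⁺ (false Vec.∷_) (allSubsets-complete S))

setWeight-∅ : ∀ {n} (H : WGraph n) → setWeight H ∅ ≡ 0ℚ
setWeight-∅ {n} H = trans (foldr-tabulate _ (const 0ℚ) empty id) (ℚ-Sum.sum-replicate-zero n)
  where
  empty : ∀ i q → (if i ∈ᵇ ∅ then weight H i else 0ℚ) + q ≡ 0ℚ + q
  empty i q = cong (λ b → (if b then weight H i else 0ℚ) + q) (lookup-replicate i false)

setWeight≤α : ∀ {n} {H : WGraph n} {S} → Independent H S → setWeight H S ≤ α H
setWeight≤α {H = H} {S} ind = subst (λ b → (if b then setWeight H S else 0ℚ) ≤ α H)
                                    (Independent⇒isIndependent ind)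
                                    (≤-foldr-⊔ _ (allSubsets-complete S))

α-attained : ∀ {n} (H : WGraph n) → ∃[ S ] Independent H S × α H ≡ setWeight H S
α-attained {n} H with foldr-⊔-selective (λ S → if isIndependent H S then setWeight H S else 0ℚ)
                                        (allSubsets n)
... | inj₁ α≡0      = ∅ , ∅-independent H , trans α≡0 (sym (setWeight-∅ H))
... | inj₂ (S , α≡) with isIndependent H S in indep
...   | true  = S , isIndependent⇒Independent indep , α≡
...   | false = ∅ , ∅-independent H , trans α≡ (sym (setWeight-∅ H))

α-transfer : ∀ {m n} (H : WGraph m) (K : WGraph n) c →
             (∀ S → Independent H S → ∃[ T ] Independent K T × setWeight H S ≤ setWeight K T + c) →
             (∀ S → Independent K S → ∃[ T ] Independent H T × setWeight K S + c ≤ setWeight H T) →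
             α H ≡ α K + c
α-transfer H K c H→K K→H with α-attained H | α-attained K
... | S , S-indep , αH≡ | S′ , S′-indep , αK≡ with H→K S S-indep | K→H S′ S′-indep
...   | T , T-indep , S≤T+c | T′ , T′-indep , S′+c≤T′ = ℚ.≤-antisym αH≤αK+c αK+c≤αH
  where
  open ℚ.≤-Reasoning
  αH≤αK+c : α H ≤ α K + c
  αH≤αK+c = begin
    α H               ≡⟨ αH≡ ⟩
    setWeight H S     ≤⟨ S≤T+c ⟩
    setWeight K T + c ≤⟨ ℚ.+-monoˡ-≤ c (setWeight≤α T-indep) ⟩
    α K + c           ∎
  αK+c≤αH : α K + c ≤ α H
  αK+c≤αH = begin
    α K + c            ≡⟨ cong (_+ c) αK≡ ⟩
    setWeight K S′ + c ≤⟨ S′+c≤T′ ⟩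
    setWeight H T′     ≤⟨ setWeight≤α T′-indep ⟩
    α H                ∎

ℚ-ring : AlmostCommutativeRing 0ℓ 0ℓ
ℚ-ring = fromCommutativeRing ℚ.+-*-commutativeRing (λ x → dec⇒maybe (0ℚ ℚ.≟ x))

𝟙 : Bool → ℚ
𝟙 b = if b then 1ℚ else 0ℚ

-- A product rather than an if-then-else, so that once the Booleans are instantiated
-- the ring solver sees the closed constants 𝟙 true, 𝟙 false.
weightIn : ∀ {n} → WGraph n → Subset n → Fin n → ℚ
weightIn H S i = 𝟙 (i ∈ᵇ S) * weight H i

weightIn-≡ : ∀ {n} (H : WGraph n) S {i b x} → i ∈ᵇ S ≡ b → weight H i ≡ x → weightIn H S i ≡ 𝟙 b * x
weightIn-≡ H S = cong₂ (λ b x → 𝟙 b * x)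

weightIn-∉ : ∀ {n} (H : WGraph n) S {i} → i ∈ᵇ S ≡ false → weightIn H S i ≡ 0ℚ
weightIn-∉ H S {i} i∉S = trans (weightIn-≡ H S i∉S refl) (ℚ.*-zeroˡ (weight H i))

setWeight≡sum : ∀ {n} (H : WGraph n) S → setWeight H S ≡ ℚ-Sum.sum (weightIn H S)
setWeight≡sum H S =
  foldr-tabulate _ (weightIn H S) (λ i q → cong (_+ q) (if≡𝟙* (i ∈ᵇ S) (weight H i))) id
  where
  if≡𝟙* : ∀ b x → (if b then x else 0ℚ) ≡ 𝟙 b * x
  if≡𝟙* true  x = sym (ℚ.*-identityˡ x)
  if≡𝟙* false x = sym (ℚ.*-zeroˡ x)

sum-localise : ∀ {n} {f g : Fin n → ℚ} L → AllPairs _≢_ L → (∀ i → All (i ≢_) L → f i ≡ g i) →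
               ℚ-Sum.sum f ≡ ℚ-Sum.sum g + (ℚ-Sum.sumAt L f - ℚ-Sum.sumAt L g)
sum-localise {f = f} {g} L distinct agree = begin
  sum f                                  ≡⟨ sum-eraseAll f L distinct ⟩
  sum (eraseAll L f) + Lf                ≡⟨ cong (_+ Lf) (sum-cong-≗ (eraseAll-cong L agree)) ⟩
  sum (eraseAll L g) + Lf                ≡⟨ shift (sum (eraseAll L g)) Lf Lg ⟩
  (sum (eraseAll L g) + Lg) + (Lf - Lg)  ≡⟨ cong (_+ (Lf - Lg)) (sym (sum-eraseAll g L distinct)) ⟩
  sum g + (Lf - Lg)                      ∎
  where
  open ℚ-Sum
  open ≡-Reasoning
  Lf = sumAt L f
  Lg = sumAt L g
  shift : ∀ x y z → x + y ≡ (x + z) + (y - z)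
  shift = solve-∀ ℚ-ring

≤-by : ∀ {x y} d → 0ℚ ≤ d → x + d ≡ y → x ≤ y
≤-by {x} d 0≤d refl = ℚ.≤-trans (ℚ.≤-reflexive (sym (ℚ.+-identityʳ x))) (ℚ.+-monoʳ-≤ x 0≤d)

p≤q⇒0≤q-p : ∀ {p q} → p ≤ q → 0ℚ ≤ q - p
p≤q⇒0≤q-p {p} p≤q = ℚ.≤-trans (ℚ.≤-reflexive (sym (ℚ.+-inverseʳ p))) (ℚ.+-monoˡ-≤ (ℚ.- p) p≤q)

module _ {w₁ w₂ w₃ w₄ w₅ : ℚ} where

  private
    ws : List ℚ
    ws = w₁ ∷ w₂ ∷ w₃ ∷ w₄ ∷ w₅ ∷ []

  module _ (0≤w₂ : 0ℚ ≤ w₂) (0≤w₃ : 0ℚ ≤ w₃) (0≤w₄ : 0ℚ ≤ w₄) (w₃≤w₂ : w₃ ≤ w₂) (w₃≤w₄ : w₃ ≤ w₄) where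

    private
      0≤w₂-w₃ = p≤q⇒0≤q-p w₃≤w₂
      0≤w₄-w₃ = p≤q⇒0≤q-p w₃≤w₄

    -- sᵢ = vᵢ ∈ S: the path terms of weightIn G S minus those of weightIn G′ (contract S).
    -- The non-absurd clauses are the 13 independent sets of the path.
    reduction-loss :
      ∀ s₁ s₂ s₃ s₄ s₅ → s₁ ∧ s₂ ≡ false → s₂ ∧ s₃ ≡ false → s₃ ∧ s₄ ≡ false → s₄ ∧ s₅ ≡ false →
      (𝟙 s₁ * w₁ + (𝟙 s₂ * w₂ + (𝟙 s₃ * w₃ + (𝟙 s₄ * w₄ + (𝟙 s₅ * w₅ + 0ℚ)))))
        - (𝟙 s₁ * (w₁ + w₃ - w₂) + (0ℚ + (𝟙 (s₂ ∧ s₄) * w₃ + (0ℚ + (𝟙 s₅ * (w₅ + w₃ - w₄) + 0ℚ)))))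
      ≤ w₂ + w₄ - w₃
    reduction-loss true  true  _     _     _     () _  _  _
    reduction-loss _     true  true  _     _     _  () _  _
    reduction-loss _     _     true  true  _     _  _  () _
    reduction-loss _     _     _     true  true  _  _  _  ()
    reduction-loss false false false false false _ _ _ _ =
      ≤-by (w₂ + (w₄ - w₃)) (ℚ.+-mono-≤ 0≤w₂ 0≤w₄-w₃) (solve ws ℚ-ring)
    reduction-loss false false false false true  _ _ _ _ = ≤-by w₂ 0≤w₂ (solve ws ℚ-ring)
    reduction-loss false false false true  false _ _ _ _ = ≤-by (w₂ - w₃) 0≤w₂-w₃ (solve ws ℚ-ring)
    reduction-loss false false true  false false _ _ _ _ =
      ≤-by ((w₂ - w₃) + (w₄ - w₃)) (ℚ.+-mono-≤ 0≤w₂-w₃ 0≤w₄-w₃) (solve ws ℚ-ring)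
    reduction-loss false false true  false true  _ _ _ _ = ≤-by (w₂ - w₃) 0≤w₂-w₃ (solve ws ℚ-ring)
    reduction-loss false true  false false false _ _ _ _ = ≤-by (w₄ - w₃) 0≤w₄-w₃ (solve ws ℚ-ring)
    reduction-loss false true  false false true  _ _ _ _ = ℚ.≤-reflexive (solve ws ℚ-ring)
    reduction-loss false true  false true  false _ _ _ _ = ℚ.≤-reflexive (solve ws ℚ-ring)
    reduction-loss true  false false false false _ _ _ _ = ≤-by w₄ 0≤w₄ (solve ws ℚ-ring)
    reduction-loss true  false false false true  _ _ _ _ = ≤-by w₃ 0≤w₃ (solve ws ℚ-ring)
    reduction-loss true  false false true  false _ _ _ _ = ℚ.≤-reflexive (solve ws ℚ-ring)
    reduction-loss true  false true  false false _ _ _ _ = ≤-by (w₄ - w₃) 0≤w₄-w₃ (solve ws ℚ-ring)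
    reduction-loss true  false true  false true  _ _ _ _ = ℚ.≤-reflexive (solve ws ℚ-ring)

  -- sᵢ = vᵢ ∈ S: the path terms of weightIn G (expand S) minus those of weightIn G′ S.
  reduction-gain :
    0ℚ ≤ w₃ → ∀ s₁ s₃ s₅ → s₁ ∧ s₃ ≡ false → s₃ ∧ s₅ ≡ false →
    w₂ + w₄ - w₃ ≤
      (𝟙 s₁ * w₁ + (𝟙 (not s₁) * w₂ + (𝟙 (s₁ ∧ s₅) * w₃ + (𝟙 (not s₅) * w₄ + (𝟙 s₅ * w₅ + 0ℚ)))))
        - (𝟙 s₁ * (w₁ + w₃ - w₂) + (0ℚ + (𝟙 s₃ * w₃ + (0ℚ + (𝟙 s₅ * (w₅ + w₃ - w₄) + 0ℚ)))))
  reduction-gain _    true  true  _     () _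
  reduction-gain _    _     true  true  _  ()
  reduction-gain 0≤w₃ false false false _  _ = ≤-by w₃ 0≤w₃ (solve ws ℚ-ring)
  reduction-gain _    false false true  _  _ = ℚ.≤-reflexive (solve ws ℚ-ring)
  reduction-gain _    false true  false _  _ = ℚ.≤-reflexive (solve ws ℚ-ring)
  reduction-gain _    true  false false _  _ = ℚ.≤-reflexive (solve ws ℚ-ring)
  reduction-gain _    true  false true  _  _ = ℚ.≤-reflexive (solve ws ℚ-ring)

-- Definitionally the local edge of reduce, so adj (reduce G v₁ v₂ v₃ v₄ v₅) i j unfolds to
-- adj G i j ∨ link i j v₁ v₃ ∨ link i j v₃ v₅.
link : ∀ {n} → Fin n → Fin n → Fin n → Fin n → Bool
link i j a b = (i == a ∧ j == b) ∨ (i == b ∧ j == a)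

link-refl : ∀ {n} (a b : Fin n) → link a b a b ≡ true
link-refl a b rewrite ==-refl a | ==-refl b = refl

link-comm : ∀ {n} (i j a b : Fin n) → link i j a b ≡ link j i a b
link-comm i j a b =
  trans (∨-comm (i == a ∧ j == b) (i == b ∧ j == a))
        (cong₂ _∨_ (∧-comm (i == b) (j == a)) (∧-comm (i == a) (j == b)))

link-avoidsˡ : ∀ {n} {i j a b : Fin n} → i ≢ a → j ≢ a → link i j a b ≡ false
link-avoidsˡ {i = i} {b = b} i≢a j≢a rewrite ==-≢ i≢a | ==-≢ j≢a | ∧-zeroʳ (i == b) = refl

link-avoidsʳ : ∀ {n} {i j a b : Fin n} → i ≢ b → j ≢ b → link i j a b ≡ false
link-avoidsʳ {i = i} {a = a} i≢b j≢b rewrite ==-≢ i≢b | ==-≢ j≢b | ∧-zeroʳ (i == a) = refl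

link-loop : ∀ {n} {a b : Fin n} → a ≢ b → ∀ i → link i i a b ≡ false
link-loop {a = a} {b} a≢b i = loop (i ≟ a)
  where
  loop : Dec (i ≡ a) → link i i a b ≡ false
  loop (yes refl) = link-avoidsʳ a≢b a≢b
  loop (no  i≢a)  = link-avoidsˡ i≢a i≢a

link⇒ : ∀ {n} {i j a b : Fin n} → link i j a b ≡ true → (i ≡ a × j ≡ b) ⊎ (i ≡ b × j ≡ a)
link⇒ {i = i} {j} {a} {b} h with ∨-true {i == a ∧ j == b} h
... | inj₁ h₁ = let i==a , j==b = ∧-true h₁ in inj₁ (==⇒≡ i==a , ==⇒≡ j==b)
... | inj₂ h₂ = let i==b , j==a = ∧-true h₂ in inj₂ (==⇒≡ i==b , ==⇒≡ j==a)

module Reduce {n} (G : WGraph n) (v₁ v₂ v₃ v₄ v₅ : Fin n) where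

  private
    G′ = reduce G v₁ v₂ v₃ v₄ v₅

  ∈-reduce⁻ : ∀ {i} → i ∈ᵇ verts G′ ≡ true → i ∈ᵇ verts G ≡ true × i ≢ v₂ × i ≢ v₄
  ∈-reduce⁻ {i} h with ∧-true {i ∈ᵇ verts G} (trans (sym (lookup∘tabulate _ i)) h)
  ... | i∈G , rest with ∧-true {not (i == v₂)} rest
  ...   | i≠v₂ , i≠v₄ = i∈G , not-==⇒≢ i≠v₂ , not-==⇒≢ i≠v₄

  ∈-reduce⁺ : ∀ {i} → i ∈ᵇ verts G ≡ true → i ≢ v₂ → i ≢ v₄ → i ∈ᵇ verts G′ ≡ true
  ∈-reduce⁺ {i} i∈G i≢v₂ i≢v₄ =
    trans (lookup∘tabulate _ i)
      (trans (cong₂ (λ x y → x ∧ not y ∧ not (i == v₄)) i∈G (==-≢ i≢v₂)) (cong not (==-≢ i≢v₄)))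

  adj-reduce-off : ∀ {i j} → i ≢ v₃ → j ≢ v₃ → adj G′ i j ≡ adj G i j
  adj-reduce-off {i} {j} i≢v₃ j≢v₃ =
    trans (cong₂ (λ x y → adj G i j ∨ x ∨ y) (link-avoidsʳ i≢v₃ j≢v₃) (link-avoidsˡ i≢v₃ j≢v₃))
          (∨-identityʳ (adj G i j))

  adj-reduce-v₁v₃ : adj G′ v₁ v₃ ≡ true
  adj-reduce-v₁v₃ =
    trans (cong (λ x → adj G v₁ v₃ ∨ x ∨ link v₁ v₃ v₃ v₅) (link-refl v₁ v₃)) (∨-zeroʳ (adj G v₁ v₃))

  adj-reduce-v₃v₅ : adj G′ v₃ v₅ ≡ true
  adj-reduce-v₃v₅ =
    trans (cong (λ x → adj G v₃ v₅ ∨ link v₃ v₅ v₁ v₃ ∨ x) (link-refl v₃ v₅))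
          (trans (cong (adj G v₃ v₅ ∨_) (∨-zeroʳ (link v₃ v₅ v₁ v₃))) (∨-zeroʳ (adj G v₃ v₅)))

  reduce-simple : IsSimple G → v₁ ≢ v₃ → v₃ ≢ v₅ → IsSimple G′
  reduce-simple (symmetric , loopless) v₁≢v₃ v₃≢v₅ =
    (λ i j → cong₂ _∨_ (symmetric i j) (cong₂ _∨_ (link-comm i j v₁ v₃) (link-comm i j v₃ v₅))) ,
    (λ i → cong₂ _∨_ (loopless i) (cong₂ _∨_ (link-loop v₁≢v₃ i) (link-loop v₃≢v₅ i)))

  reduce-NeighboursWithin : v₁ ≢ v₃ → v₃ ≢ v₅ →
                            NeighboursWithin G v₃ v₂ v₄ → NeighboursWithin G′ v₃ v₁ v₅
  reduce-NeighboursWithin v₁≢v₃ v₃≢v₅ N {j} j∈G′ v₃j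
    with ∈-reduce⁻ j∈G′ | ∨-true {adj G v₃ j} v₃j
  ... | j∈G , j≢v₂ , j≢v₄ | inj₁ old = ⊥-elim ([ j≢v₂ , j≢v₄ ]′ (N j∈G old))
  ... | _                 | inj₂ new with ∨-true {link v₃ j v₁ v₃} new
  ...   | inj₁ to-v₁ = [ (λ (v₃≡v₁ , _) → ⊥-elim (v₁≢v₃ (sym v₃≡v₁))) , inj₁ ∘ proj₂ ]′ (link⇒ to-v₁)
  ...   | inj₂ to-v₅ = [ inj₂ ∘ proj₂ , (λ (v₃≡v₅ , _) → ⊥-elim (v₃≢v₅ v₃≡v₅)) ]′ (link⇒ to-v₅)

  weight-reduce-v₁ : weight G′ v₁ ≡ weight G v₁ + weight G v₃ - weight G v₂
  weight-reduce-v₁ rewrite ==-refl v₁ = refl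

  weight-reduce-v₅ : v₁ ≢ v₅ → weight G′ v₅ ≡ weight G v₅ + weight G v₃ - weight G v₄
  weight-reduce-v₅ v₁≢v₅ rewrite ==-≢ (v₁≢v₅ ∘ sym) | ==-refl v₅ = refl

  weight-reduce-off : ∀ {i} → i ≢ v₁ → i ≢ v₅ → weight G′ i ≡ weight G i
  weight-reduce-off i≢v₁ i≢v₅ rewrite ==-≢ i≢v₁ | ==-≢ i≢v₅ = refl

  Independent-reduce⁻ : ∀ {S} → Independent G′ S → Independent G S
  Independent-reduce⁻ ind = record
    { ⊆-verts = λ i∈S → proj₁ (∈-reduce⁻ (⊆-verts ind i∈S))
    ; no-edge = λ {i} {j} i∈S j∈S → ∨-conicalˡ (adj G i j) _ (no-edge ind i∈S j∈S)
    }

  Independent-reduce⁺ : ∀ {S} → Independent G S →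
                        v₂ ∈ᵇ S ≡ false → v₃ ∈ᵇ S ≡ false → v₄ ∈ᵇ S ≡ false → Independent G′ S
  Independent-reduce⁺ {S} ind v₂∉S v₃∉S v₄∉S = record
    { ⊆-verts = λ i∈S → ∈-reduce⁺ (⊆-verts ind i∈S) (∈∉⇒≢ {S = S} i∈S v₂∉S) (∈∉⇒≢ {S = S} i∈S v₄∉S)
    ; no-edge = λ i∈S j∈S → trans (adj-reduce-off (∈∉⇒≢ {S = S} i∈S v₃∉S) (∈∉⇒≢ {S = S} j∈S v₃∉S))
                                  (no-edge ind i∈S j∈S)
    }

module PathReduction {n} (G : WGraph n) (simple : IsSimple G) (pos : PositiveWeights G)
  {v₁ v₂ v₃ v₄ v₅ : Fin n}
  (v₁∈G : v₁ ∈ᵇ verts G ≡ true) (v₂∈G : v₂ ∈ᵇ verts G ≡ true) (v₃∈G : v₃ ∈ᵇ verts G ≡ true)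
  (v₄∈G : v₄ ∈ᵇ verts G ≡ true) (v₅∈G : v₅ ∈ᵇ verts G ≡ true)
  (v₁≢v₂ : v₁ ≢ v₂) (v₁≢v₃ : v₁ ≢ v₃) (v₁≢v₄ : v₁ ≢ v₄) (v₁≢v₅ : v₁ ≢ v₅) (v₂≢v₃ : v₂ ≢ v₃)
  (v₂≢v₄ : v₂ ≢ v₄) (v₂≢v₅ : v₂ ≢ v₅) (v₃≢v₄ : v₃ ≢ v₄) (v₃≢v₅ : v₃ ≢ v₅) (v₄≢v₅ : v₄ ≢ v₅)
  (v₁v₂ : adj G v₁ v₂ ≡ true) (v₂v₃ : adj G v₂ v₃ ≡ true)
  (v₃v₄ : adj G v₃ v₄ ≡ true) (v₄v₅ : adj G v₄ v₅ ≡ true)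
  (deg₂ : degree G v₂ ≡ 2) (deg₃ : degree G v₃ ≡ 2) (deg₄ : degree G v₄ ≡ 2)
  (w₃≤w₂ : weight G v₃ ≤ weight G v₂) (w₃≤w₄ : weight G v₃ ≤ weight G v₄)
  where

  open Reduce G v₁ v₂ v₃ v₄ v₅
  open ℚ-Sum using (sum; sumAt)

  G′ : WGraph n
  G′ = reduce G v₁ v₂ v₃ v₄ v₅

  w₁ w₂ w₃ w₄ w₅ c : ℚ
  w₁ = weight G v₁
  w₂ = weight G v₂
  w₃ = weight G v₃
  w₄ = weight G v₄
  w₅ = weight G v₅
  c  = w₂ + w₄ - w₃

  0≤weight : ∀ {i} → i ∈ᵇ verts G ≡ true → 0ℚ ≤ weight G i
  0≤weight {i} i∈G = ℚ.<⇒≤ (ℚ.positive⁻¹ (weight G i) {{pos i i∈G}})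

  N₂ : NeighboursWithin G v₂ v₁ v₃
  N₂ = degree-2⇒NeighboursWithin G deg₂ v₁≢v₃ v₁∈G (trans (proj₁ simple v₂ v₁) v₁v₂) v₃∈G v₂v₃

  N₃ : NeighboursWithin G v₃ v₂ v₄
  N₃ = degree-2⇒NeighboursWithin G deg₃ v₂≢v₄ v₂∈G (trans (proj₁ simple v₃ v₂) v₂v₃) v₄∈G v₃v₄

  N₄ : NeighboursWithin G v₄ v₃ v₅
  N₄ = degree-2⇒NeighboursWithin G deg₄ v₃≢v₅ v₃∈G (trans (proj₁ simple v₄ v₃) v₃v₄) v₅∈G v₄v₅

  -- v₃ is emptied first so that every later update adds at most one vertex (Independent-≔).
  setSides : Subset n → Bool → Bool → Subset n
  setSides S b₂ b₄ = S [ v₃ ]≔ false [ v₂ ]≔ b₂ [ v₄ ]≔ b₄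

  rewire : Subset n → Bool → Bool → Bool → Subset n
  rewire S b₂ b₃ b₄ = setSides S b₂ b₄ [ v₃ ]≔ b₃

  module _ (S : Subset n) {b₂ b₄ : Bool} where

    private
      S₃ S₃₂ : Subset n
      S₃  = S [ v₃ ]≔ false
      S₃₂ = S₃ [ v₂ ]≔ b₂

    setSides-v₂ : v₂ ∈ᵇ setSides S b₂ b₄ ≡ b₂
    setSides-v₂ = trans (≔-there S₃₂ v₂≢v₄) (≔-here S₃ v₂)

    setSides-v₃ : v₃ ∈ᵇ setSides S b₂ b₄ ≡ false
    setSides-v₃ = trans (≔-there S₃₂ v₃≢v₄) (trans (≔-there S₃ (v₂≢v₃ ∘ sym)) (≔-here S v₃))

    setSides-v₄ : v₄ ∈ᵇ setSides S b₂ b₄ ≡ b₄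
    setSides-v₄ = ≔-here S₃₂ v₄

    setSides-off : ∀ {i} → i ≢ v₂ → i ≢ v₃ → i ≢ v₄ → i ∈ᵇ setSides S b₂ b₄ ≡ i ∈ᵇ S
    setSides-off i≢v₂ i≢v₃ i≢v₄ = trans (≔-there S₃₂ i≢v₄) (trans (≔-there S₃ i≢v₂) (≔-there S i≢v₃))

    module _ {b₃ : Bool} where

      rewire-v₂ : v₂ ∈ᵇ rewire S b₂ b₃ b₄ ≡ b₂
      rewire-v₂ = trans (≔-there (setSides S b₂ b₄) v₂≢v₃) setSides-v₂

      rewire-v₃ : v₃ ∈ᵇ rewire S b₂ b₃ b₄ ≡ b₃
      rewire-v₃ = ≔-here (setSides S b₂ b₄) v₃

      rewire-v₄ : v₄ ∈ᵇ rewire S b₂ b₃ b₄ ≡ b₄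
      rewire-v₄ = trans (≔-there (setSides S b₂ b₄) (v₃≢v₄ ∘ sym)) setSides-v₄

      rewire-off : ∀ {i} → i ≢ v₂ → i ≢ v₃ → i ≢ v₄ → i ∈ᵇ rewire S b₂ b₃ b₄ ≡ i ∈ᵇ S
      rewire-off i≢v₂ i≢v₃ i≢v₄ = trans (≔-there (setSides S b₂ b₄) i≢v₃) (setSides-off i≢v₂ i≢v₃ i≢v₄)

  path : List (Fin n)
  path = v₁ ∷ v₂ ∷ v₃ ∷ v₄ ∷ v₅ ∷ []

  path-distinct : AllPairs _≢_ path
  path-distinct = (v₁≢v₂ ∷ v₁≢v₃ ∷ v₁≢v₄ ∷ v₁≢v₅ ∷ []) ∷ (v₂≢v₃ ∷ v₂≢v₄ ∷ v₂≢v₅ ∷ []) ∷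
                  (v₃≢v₄ ∷ v₃≢v₅ ∷ []) ∷ (v₄≢v₅ ∷ []) ∷ [] ∷ []

  sumAt-path : ∀ (f : Fin n → ℚ) {x₁ x₂ x₃ x₄ x₅} →
               f v₁ ≡ x₁ → f v₂ ≡ x₂ → f v₃ ≡ x₃ → f v₄ ≡ x₄ → f v₅ ≡ x₅ →
               sumAt path f ≡ x₁ + (x₂ + (x₃ + (x₄ + (x₅ + 0ℚ))))
  sumAt-path f e₁ e₂ e₃ e₄ e₅ =
    cong₂ _+_ e₁ (cong₂ _+_ e₂ (cong₂ _+_ e₃ (cong₂ _+_ e₄ (cong₂ _+_ e₅ refl))))

  contract : Subset n → Subset n
  contract S = rewire S false (v₂ ∈ᵇ S ∧ v₄ ∈ᵇ S) false

  expand : Subset n → Subset n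
  expand S = rewire S (not (v₁ ∈ᵇ S)) (v₁ ∈ᵇ S ∧ v₅ ∈ᵇ S) (not (v₅ ∈ᵇ S))

  contract-independent : ∀ {S} → Independent G S → Independent G′ (contract S)
  contract-independent {S} S-indep =
    Independent-≔ (reduce-simple simple v₁≢v₃ v₃≢v₅) R-indep λ s₂∧s₄ →
      ∈-reduce⁺ v₃∈G (v₂≢v₃ ∘ sym) v₃≢v₄ ,
      NeighboursWithin⇒NoNeighbourIn (reduce-NeighboursWithin v₁≢v₃ v₃≢v₅ N₃) R-indep
        (trans (setSides-off S v₁≢v₂ v₁≢v₃ v₁≢v₄)
               (∧-false (edge-not-both S-indep v₁v₂) (proj₁ (∧-true {v₂ ∈ᵇ S} s₂∧s₄))))
        (trans (setSides-off S (v₂≢v₅ ∘ sym) (v₃≢v₅ ∘ sym) (v₄≢v₅ ∘ sym))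
               (∧-false (trans (∧-comm (v₅ ∈ᵇ S) (v₄ ∈ᵇ S)) (edge-not-both S-indep v₄v₅))
                        (proj₂ (∧-true {v₂ ∈ᵇ S} s₂∧s₄))))
    where
    R-indep : Independent G′ (setSides S false false)
    R-indep = Independent-reduce⁺
      (Independent-≔ simple (Independent-≔ simple (Independent-≔ simple S-indep λ ()) λ ()) λ ())
      (setSides-v₂ S) (setSides-v₃ S) (setSides-v₄ S)

  contract-weight : ∀ {S} → Independent G S → setWeight G S ≤ setWeight G′ (contract S) + c
  contract-weight {S} S-indep = begin
    setWeight G S                 ≡⟨ setWeight≡sum G S ⟩
    sum (weightIn G S)            ≡⟨ sum-localise path path-distinct agree ⟩
    sum (weightIn G′ T) + (sumAt path (weightIn G S) - sumAt path (weightIn G′ T))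
                                  ≤⟨ ℚ.+-monoʳ-≤ (sum (weightIn G′ T)) loss ⟩
    sum (weightIn G′ T) + c       ≡⟨ cong (_+ c) (sym (setWeight≡sum G′ T)) ⟩
    setWeight G′ T + c            ∎
    where
    open ℚ.≤-Reasoning
    T = contract S
    s₁ = v₁ ∈ᵇ S
    s₂ = v₂ ∈ᵇ S
    s₄ = v₄ ∈ᵇ S
    s₅ = v₅ ∈ᵇ S

    agree : ∀ i → All (i ≢_) path → weightIn G S i ≡ weightIn G′ T i
    agree i (i≢v₁ ∷ i≢v₂ ∷ i≢v₃ ∷ i≢v₄ ∷ i≢v₅ ∷ []) =
      sym (weightIn-≡ G′ T (rewire-off S i≢v₂ i≢v₃ i≢v₄) (weight-reduce-off i≢v₁ i≢v₅))

    T-on-path : sumAt path (weightIn G′ T) ≡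
                𝟙 s₁ * (w₁ + w₃ - w₂) + (0ℚ + (𝟙 (s₂ ∧ s₄) * w₃ + (0ℚ + (𝟙 s₅ * (w₅ + w₃ - w₄) + 0ℚ))))
    T-on-path = sumAt-path (weightIn G′ T)
      (weightIn-≡ G′ T (rewire-off S v₁≢v₂ v₁≢v₃ v₁≢v₄) weight-reduce-v₁)
      (weightIn-∉ G′ T (rewire-v₂ S))
      (weightIn-≡ G′ T (rewire-v₃ S) (weight-reduce-off (v₁≢v₃ ∘ sym) v₃≢v₅))
      (weightIn-∉ G′ T (rewire-v₄ S))
      (weightIn-≡ G′ T (rewire-off S (v₂≢v₅ ∘ sym) (v₃≢v₅ ∘ sym) (v₄≢v₅ ∘ sym)) (weight-reduce-v₅ v₁≢v₅))

    loss : sumAt path (weightIn G S) - sumAt path (weightIn G′ T) ≤ c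
    loss = subst (λ x → sumAt path (weightIn G S) - x ≤ c) (sym T-on-path)
      (reduction-loss (0≤weight v₂∈G) (0≤weight v₃∈G) (0≤weight v₄∈G) w₃≤w₂ w₃≤w₄ s₁ s₂ (v₃ ∈ᵇ S) s₄ s₅
        (edge-not-both S-indep v₁v₂) (edge-not-both S-indep v₂v₃)
        (edge-not-both S-indep v₃v₄) (edge-not-both S-indep v₄v₅))

  expand-independent : ∀ {S} → Independent G′ S → Independent G (expand S)
  expand-independent {S} S-indep′ =
    Independent-≔ simple R₂-indep λ s₁∧s₅ →
      v₃∈G , NeighboursWithin⇒NoNeighbourIn N₃ R₂-indep
               (trans (setSides-v₂ S) (cong not (proj₁ (∧-true s₁∧s₅))))
               (trans (setSides-v₄ S) (cong not (proj₂ (∧-true s₁∧s₅))))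
    where
    s₁ = v₁ ∈ᵇ S
    s₅ = v₅ ∈ᵇ S
    R₀ = S [ v₃ ]≔ false

    R₀-indep : Independent G R₀
    R₀-indep = Independent-≔ simple (Independent-reduce⁻ S-indep′) λ ()

    R₁-indep : Independent G (R₀ [ v₂ ]≔ not s₁)
    R₁-indep = Independent-≔ simple R₀-indep λ ¬s₁ →
      v₂∈G , NeighboursWithin⇒NoNeighbourIn N₂ R₀-indep
               (trans (≔-there S v₁≢v₃) (not-true ¬s₁)) (≔-here S v₃)

    R₂-indep : Independent G (setSides S (not s₁) (not s₅))
    R₂-indep = Independent-≔ simple R₁-indep λ ¬s₅ →
      v₄∈G , NeighboursWithin⇒NoNeighbourIn N₄ R₁-indep
               (trans (≔-there R₀ (v₂≢v₃ ∘ sym)) (≔-here S v₃))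
               (trans (≔-there R₀ (v₂≢v₅ ∘ sym)) (trans (≔-there S (v₃≢v₅ ∘ sym)) (not-true ¬s₅)))

  toReduced : ∀ S → Independent G S → ∃[ T ] Independent G′ T × setWeight G S ≤ setWeight G′ T + c
  toReduced S S-indep = contract S , contract-independent S-indep , contract-weight S-indep

  expand-weight : ∀ {S} → Independent G′ S → setWeight G′ S + c ≤ setWeight G (expand S)
  expand-weight {S} S-indep′ = begin
    setWeight G′ S + c        ≡⟨ cong (_+ c) (setWeight≡sum G′ S) ⟩
    sum (weightIn G′ S) + c   ≤⟨ ℚ.+-monoʳ-≤ (sum (weightIn G′ S)) gain ⟩
    sum (weightIn G′ S) + (sumAt path (weightIn G T) - sumAt path (weightIn G′ S))
                              ≡⟨ sym (sum-localise path path-distinct agree) ⟩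
    sum (weightIn G T)        ≡⟨ sym (setWeight≡sum G T) ⟩
    setWeight G T             ∎
    where
    open ℚ.≤-Reasoning
    T = expand S
    s₁ = v₁ ∈ᵇ S
    s₃ = v₃ ∈ᵇ S
    s₅ = v₅ ∈ᵇ S

    v₂∉S : v₂ ∈ᵇ S ≡ false
    v₂∉S = ¬-not λ v₂∈S → proj₁ (proj₂ (∈-reduce⁻ (⊆-verts S-indep′ v₂∈S))) refl

    v₄∉S : v₄ ∈ᵇ S ≡ false
    v₄∉S = ¬-not λ v₄∈S → proj₂ (proj₂ (∈-reduce⁻ (⊆-verts S-indep′ v₄∈S))) refl

    agree : ∀ i → All (i ≢_) path → weightIn G T i ≡ weightIn G′ S i
    agree i (i≢v₁ ∷ i≢v₂ ∷ i≢v₃ ∷ i≢v₄ ∷ i≢v₅ ∷ []) =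
      weightIn-≡ G T (rewire-off S i≢v₂ i≢v₃ i≢v₄) (sym (weight-reduce-off i≢v₁ i≢v₅))

    T-on-path : sumAt path (weightIn G T) ≡
                𝟙 s₁ * w₁ + (𝟙 (not s₁) * w₂ + (𝟙 (s₁ ∧ s₅) * w₃ + (𝟙 (not s₅) * w₄ + (𝟙 s₅ * w₅ + 0ℚ))))
    T-on-path = sumAt-path (weightIn G T)
      (weightIn-≡ G T (rewire-off S v₁≢v₂ v₁≢v₃ v₁≢v₄) refl)
      (weightIn-≡ G T (rewire-v₂ S) refl)
      (weightIn-≡ G T (rewire-v₃ S) refl)
      (weightIn-≡ G T (rewire-v₄ S) refl)
      (weightIn-≡ G T (rewire-off S (v₂≢v₅ ∘ sym) (v₃≢v₅ ∘ sym) (v₄≢v₅ ∘ sym)) refl)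

    S-on-path : sumAt path (weightIn G′ S) ≡
                𝟙 s₁ * (w₁ + w₃ - w₂) + (0ℚ + (𝟙 s₃ * w₃ + (0ℚ + (𝟙 s₅ * (w₅ + w₃ - w₄) + 0ℚ))))
    S-on-path = sumAt-path (weightIn G′ S)
      (weightIn-≡ G′ S refl weight-reduce-v₁)
      (weightIn-∉ G′ S v₂∉S)
      (weightIn-≡ G′ S refl (weight-reduce-off (v₁≢v₃ ∘ sym) v₃≢v₅))
      (weightIn-∉ G′ S v₄∉S)
      (weightIn-≡ G′ S refl (weight-reduce-v₅ v₁≢v₅))

    gain : c ≤ sumAt path (weightIn G T) - sumAt path (weightIn G′ S)
    gain = subst₂ (λ x y → c ≤ x - y) (sym T-on-path) (sym S-on-path)
      (reduction-gain (0≤weight v₃∈G) s₁ s₃ s₅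
        (edge-not-both S-indep′ adj-reduce-v₁v₃) (edge-not-both S-indep′ adj-reduce-v₃v₅))

  fromReduced : ∀ S → Independent G′ S → ∃[ T ] Independent G T × setWeight G′ S + c ≤ setWeight G T
  fromReduced S S-indep = expand S , expand-independent S-indep , expand-weight S-indep

-- The hypotheses w(v₁) ≥ w(v₂) and w(v₄) ≤ w(v₅) only make the new weights of G′ positive;
-- the identity holds without them.
lemma6 : ∀ {n} (G : WGraph n) → IsSimple G → PositiveWeights G →
    (v₁ v₂ v₃ v₄ v₅ : Fin n) →
    v₁ ∈ᵇ verts G ≡ true → v₂ ∈ᵇ verts G ≡ true → v₃ ∈ᵇ verts G ≡ true →
    v₄ ∈ᵇ verts G ≡ true → v₅ ∈ᵇ verts G ≡ true →
    AllPairs _≢_ (v₁ ∷ v₂ ∷ v₃ ∷ v₄ ∷ v₅ ∷ []) →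
    adj G v₁ v₂ ≡ true → adj G v₂ v₃ ≡ true → adj G v₃ v₄ ≡ true → adj G v₄ v₅ ≡ true →
    degree G v₂ ≡ 2 → degree G v₃ ≡ 2 → degree G v₄ ≡ 2 →
    weight G v₂ ≤ weight G v₁ → weight G v₃ ≤ weight G v₂ →
    weight G v₃ ≤ weight G v₄ → weight G v₄ ≤ weight G v₅ →
    α G ≡ α (reduce G v₁ v₂ v₃ v₄ v₅) + weight G v₂ + weight G v₄ - weight G v₃
lemma6 G simple pos v₁ v₂ v₃ v₄ v₅ v₁∈G v₂∈G v₃∈G v₄∈G v₅∈G
  ((v₁≢v₂ ∷ v₁≢v₃ ∷ v₁≢v₄ ∷ v₁≢v₅ ∷ []) ∷ (v₂≢v₃ ∷ v₂≢v₄ ∷ v₂≢v₅ ∷ []) ∷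
   (v₃≢v₄ ∷ v₃≢v₅ ∷ []) ∷ (v₄≢v₅ ∷ []) ∷ [] ∷ [])
  v₁v₂ v₂v₃ v₃v₄ v₄v₅ deg₂ deg₃ deg₄ _ w₃≤w₂ w₃≤w₄ _ = begin
    α G                  ≡⟨ α-transfer G G′ c toReduced fromReduced ⟩
    α G′ + c             ≡⟨ regroup (α G′) w₂ w₄ w₃ ⟩
    α G′ + w₂ + w₄ - w₃  ∎
  where
  open ≡-Reasoning
  open PathReduction G simple pos v₁∈G v₂∈G v₃∈G v₄∈G v₅∈G
    v₁≢v₂ v₁≢v₃ v₁≢v₄ v₁≢v₅ v₂≢v₃ v₂≢v₄ v₂≢v₅ v₃≢v₄ v₃≢v₅ v₄≢v₅
    v₁v₂ v₂v₃ v₃v₄ v₄v₅ deg₂ deg₃ deg₄ w₃≤w₂ w₃≤w₄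
  regroup : ∀ a x y z → a + (x + y - z) ≡ a + x + y - z
  regroup = solve-∀ ℚ-ring
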